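{- Let $G$ be a left-compressed $3$-graph on the vertex set $[t]$ with $m$ edges. If $$m\ge \frac{(t-3)^2t^3}{6(t-2)(t-1)},$$ then $G$ contains a clique of order $\lfloor \frac{t-2}{2}\rfloor$.
   Context: A $3$-graph $G$ on vertex set $[t]=\{1,\dots,t\}$ has an edge set $E$ of $3$-element subsets of $[t]$; an edge $\{a,b,c\}$ is written $abc$. $G$ is left-compressed if whenever $j_1j_2j_3\in E$ and $i_1,i_2,i_3$ are distinct with $i_p\le j_p$ for $p=1,2,3$, then $i_1i_2i_3\in E$. A clique of order $s$ is a set of $s$ vertices all of whose $3$-subsets are edges of $G$. -}

module Defs where

open import Data.Nat using (ℕ; _+_; _≤_; _<_)
open import Data.Fin using (Fin; toℕ)
open import Data.Bool using (Bool; true)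
open import Data.List using (List; length; filter; allFin; concatMap)
open import Data.List.Relation.Unary.Unique.Propositional using (Unique)
open import Data.List.Membership.Propositional using (_∈_)
open import Relation.Binary.PropositionalEquality using (_≡_)
open import Relation.Nullary using (¬_)
open import Data.Product using (_×_; _,_)

-- Vertex set [t] is represented by Fin t, vertex i+1 ↦ i (order preserved).
-- A 3-graph is given by a Boolean function E on triples; E a b c = true with
-- a < b < c (as naturals) means the 3-set {a,b,c} is an edge. The values of E
-- on triples that are not strictly increasing are irrelevant.
3Graph : ℕ → Set
3Graph t = Fin t → Fin t → Fin t → Bool

_<ᶠ_ : ∀ {t} → Fin t → Fin t → Set
a <ᶠ b = toℕ a < toℕ b

_≤ᶠ_ : ∀ {t} → Fin t → Fin t → Set
a ≤ᶠ b = toℕ a ≤ toℕ b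

-- The 3-set {x,y,z} (x,y,z pairwise distinct) is an edge: E holds on its
-- increasing enumeration.
IsEdge : ∀ {t} → 3Graph t → Fin t → Fin t → Fin t → Set
IsEdge {t} E x y z =
  ∀ (a b c : Fin t) → a <ᶠ b → b <ᶠ c →
  (x ≡ a × y ≡ b × z ≡ c) ⊎' (x ≡ a × y ≡ c × z ≡ b) ⊎' (x ≡ b × y ≡ a × z ≡ c) ⊎'
  (x ≡ b × y ≡ c × z ≡ a) ⊎' (x ≡ c × y ≡ a × z ≡ b) ⊎' (x ≡ c × y ≡ b × z ≡ a) →
  E a b c ≡ true
  where
  open import Data.Sum using () renaming (_⊎_ to _⊎'_)

LeftCompressed : ∀ {t} → 3Graph t → Set
LeftCompressed {t} E =
  ∀ (j₁ j₂ j₃ i₁ i₂ i₃ : Fin t) → j₁ <ᶠ j₂ → j₂ <ᶠ j₃ → E j₁ j₂ j₃ ≡ true →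
  ¬ (i₁ ≡ i₂) → ¬ (i₁ ≡ i₃) → ¬ (i₂ ≡ i₃) →
  i₁ ≤ᶠ j₁ → i₂ ≤ᶠ j₂ → i₃ ≤ᶠ j₃ → IsEdge E i₁ i₂ i₃

triples : (t : ℕ) → List (Fin t × Fin t × Fin t)
triples t = concatMap (λ a → concatMap (λ b → Data.List.map (λ c → (a , b , c)) (allFin t)) (allFin t)) (allFin t)
  where import Data.List

numEdges : ∀ {t} → 3Graph t → ℕ
numEdges {t} E = length (filter incEdge? (triples t))
  where
  open import Relation.Nullary using (Dec)
  open import Relation.Nullary.Decidable using (_×-dec_)
  open import Data.Nat using (_<?_)
  open import Data.Bool using (_≟_)
  incEdge? : (p : Fin t × Fin t × Fin t) → Dec (let (a , b , c) = p in
               (a <ᶠ b) × (b <ᶠ c) × (E a b c ≡ true))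
  incEdge? (a , b , c) = (toℕ a <? toℕ b) ×-dec ((toℕ b <? toℕ c) ×-dec (E a b c ≟ true))

IsClique : ∀ {t} → 3Graph t → List (Fin t) → Set
IsClique E S = Unique S × (∀ x y z → x ∈ S → y ∈ S → z ∈ S →
  ¬ (x ≡ y) → ¬ (x ≡ z) → ¬ (y ≡ z) → IsEdge E x y z)

module Submission where

open import Defs
open import Data.Nat using (ℕ; _*_; _∸_; _≤_; _/_; _^_)
open import Data.List using (List; length)
open import Data.Product using (Σ; _×_)
open import Data.Fin using (Fin)
open import Relation.Binary.PropositionalEquality using (_≡_)

open import Data.Nat using (zero; suc; _+_; _%_; _<_; z≤n; s≤s; z<s; _<?_)
open import Data.Nat.Properties
open import Data.Nat.DivMod using (m≡m%n+[m/n]*n; m%n<n)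
open import Data.Nat.Tactic.RingSolver using (solve-∀)
open import Data.Fin using (toℕ; fromℕ<; inject≤)
import Data.Fin as Fin
open import Data.Fin.Properties using (toℕ-fromℕ<; toℕ-inject≤; toℕ-injective; toℕ<n)
open import Data.List using ([]; _∷_; _++_; filter; concatMap; tabulate; allFin)
import Data.List as List
open import Data.List.Properties using (length-tabulate)
open import Data.List.Membership.Propositional using (_∈_)
open import Data.List.Membership.Propositional.Properties using (∈-tabulate⁻)
open import Data.List.Relation.Unary.Unique.Propositional using (Unique)
open import Data.List.Relation.Unary.Unique.Propositional.Properties using (tabulate⁺)
open import Data.Product using (_,_)
open import Data.Sum using (_⊎_; inj₁; inj₂)
open import Data.Empty using (⊥; ⊥-elim)
open import Data.Bool using (true; false)
open import Relation.Nullary using (Dec; yes; no; ¬_)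
open import Relation.Nullary.Decidable using (_×-dec_)
open import Relation.Unary using (Decidable)
open import Function using (id)
open import Relation.Binary.PropositionalEquality using (refl; sym; trans; cong; cong₂; subst; subst₂; module ≡-Reasoning)

-- Write t = 2 + r + 2s with r ∈ {0,1}, so s = ⌊(t-2)/2⌋; we show that the
-- first s vertices 0,…,s-1 form a clique.  For s ≤ 2 there is nothing to check.  Otherwise
-- s = k+3, and left-compression makes the top triple {k, k+1, k+2} of [s] decisive:
--   * if it is an edge, every triple a<b<c<s lies coordinatewise below it, so is an edge;
--   * if not, no edge abc has a ≥ k (the top triple would lie below it), so every edge has
--     its smallest vertex below k and  m ≤ N(k,t) := #{a<b<c<t : a<k}.
-- The second case contradicts the hypothesis on m: since 6·N(k,k+m') has the closed form
-- k³+2k+3m'k²+3km'²-3k²-6m'k, for t ∈ {2k+8, 2k+9} one gets 6(t-2)(t-1)N(k,t) < (t-3)²t³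
-- by a polynomial identity with positive remainder.

indicator : ∀ {p} {P : Set p} → Dec P → ℕ
indicator (yes _) = 1
indicator (no _)  = 0

indicator-yes : ∀ {p} {P : Set p} (d : Dec P) → P → indicator d ≡ 1
indicator-yes (yes _) _  = refl
indicator-yes (no ¬p) p = ⊥-elim (¬p p)

indicator-no : ∀ {p} {P : Set p} (d : Dec P) → ¬ P → indicator d ≡ 0
indicator-no (yes p) ¬p = ⊥-elim (¬p p)
indicator-no (no _)  _  = refl

indicator-cong : ∀ {p q} {P : Set p} {Q : Set q} (d : Dec P) (e : Dec Q) →
  (P → Q) → (Q → P) → indicator d ≡ indicator e
indicator-cong (yes p) e to _    = sym (indicator-yes e (to p))
indicator-cong (no ¬p) e _  from = sym (indicator-no e (λ q → ¬p (from q)))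

total : ∀ {a} {A : Set a} → (A → ℕ) → List A → ℕ
total g []       = 0
total g (x ∷ xs) = g x + total g xs

total-++ : ∀ {a} {A : Set a} (g : A → ℕ) xs ys → total g (xs ++ ys) ≡ total g xs + total g ys
total-++ g []       ys = refl
total-++ g (x ∷ xs) ys = trans (cong (g x +_) (total-++ g xs ys)) (sym (+-assoc (g x) _ _))

total-concatMap : ∀ {a b} {A : Set a} {B : Set b} (g : B → ℕ) (f : A → List B) xs →
  total g (concatMap f xs) ≡ total (λ x → total g (f x)) xs
total-concatMap g f []       = refl
total-concatMap g f (x ∷ xs) =
  trans (total-++ g (f x) (concatMap f xs)) (cong (total g (f x) +_) (total-concatMap g f xs))

total-map : ∀ {a b} {A : Set a} {B : Set b} (g : B → ℕ) (h : A → B) xs →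
  total g (List.map h xs) ≡ total (λ x → g (h x)) xs
total-map g h []       = refl
total-map g h (x ∷ xs) = cong (g (h x) +_) (total-map g h xs)

length-filter≤total : ∀ {a} {A : Set a} {P Q : A → Set} (P? : Decidable P) (Q? : Decidable Q) →
  (∀ x → P x → Q x) → ∀ xs → length (filter P? xs) ≤ total (λ x → indicator (Q? x)) xs
length-filter≤total P? Q? P⇒Q [] = z≤n
length-filter≤total P? Q? P⇒Q (x ∷ xs) with P? x | Q? x
... | yes _  | yes _  = s≤s (length-filter≤total P? Q? P⇒Q xs)
... | yes px | no ¬qx = ⊥-elim (¬qx (P⇒Q x px))
... | no _   | q      = ≤-trans (length-filter≤total P? Q? P⇒Q xs) (m≤n+m _ (indicator q))

sumBelow : (ℕ → ℕ) → ℕ → ℕ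
sumBelow f zero    = 0
sumBelow f (suc n) = sumBelow f n + f n

sumBelow-front : ∀ f n → sumBelow f (suc n) ≡ f 0 + sumBelow (λ i → f (suc i)) n
sumBelow-front f zero    = +-comm 0 (f 0)
sumBelow-front f (suc n) = trans (cong (_+ f (suc n)) (sumBelow-front f n)) (+-assoc (f 0) _ _)

sumBelow-cong : ∀ {f g} n → (∀ i → i < n → f i ≡ g i) → sumBelow f n ≡ sumBelow g n
sumBelow-cong zero    _ = refl
sumBelow-cong (suc n) f≡g =
  cong₂ _+_ (sumBelow-cong n (λ i i<n → f≡g i (m<n⇒m<1+n i<n))) (f≡g n (n<1+n n))

sumBelow-+ : ∀ f g n → sumBelow (λ i → f i + g i) n ≡ sumBelow f n + sumBelow g n
sumBelow-+ f g zero    = refl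
sumBelow-+ f g (suc n) =
  trans (cong (_+ (f n + g n)) (sumBelow-+ f g n)) (swap-middle (sumBelow f n) (sumBelow g n) (f n) (g n))
  where
  swap-middle : ∀ a b c d → a + b + (c + d) ≡ a + c + (b + d)
  swap-middle = solve-∀

sumBelow-zero : ∀ {f} n → (∀ i → i < n → f i ≡ 0) → sumBelow f n ≡ 0
sumBelow-zero zero    _   = refl
sumBelow-zero (suc n) f≡0 =
  cong₂ _+_ (sumBelow-zero n (λ i i<n → f≡0 i (m<n⇒m<1+n i<n))) (f≡0 n (n<1+n n))

total-tabulate : ∀ {a} {A : Set a} n (f : Fin n → A) (h : A → ℕ) (G : ℕ → ℕ) →
  (∀ i → h (f i) ≡ G (toℕ i)) → total h (tabulate f) ≡ sumBelow G n
total-tabulate zero    f h G eq = refl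
total-tabulate (suc n) f h G eq =
  trans (cong₂ _+_ (eq Fin.zero)
                   (total-tabulate n (λ i → f (Fin.suc i)) h (λ i → G (suc i)) (λ i → eq (Fin.suc i))))
        (sym (sumBelow-front G n))

countBelow : ℕ → ℕ → ℕ
countBelow k = sumBelow (λ i → indicator (i <? k))

countBelow-≤ : ∀ k n → n ≤ k → countBelow k n ≡ n
countBelow-≤ k zero    _   = refl
countBelow-≤ k (suc n) n<k =
  trans (cong₂ _+_ (countBelow-≤ k n (≤-trans (n≤1+n n) n<k)) (indicator-yes (n <? k) n<k)) (+-comm n 1)

countBelow-≥ : ∀ k m → countBelow k (k + m) ≡ k
countBelow-≥ k zero    rewrite +-identityʳ k = countBelow-≤ k k ≤-refl
countBelow-≥ k (suc m) rewrite +-suc k m =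
  trans (cong₂ _+_ (countBelow-≥ k m) (indicator-no ((k + m) <? k) (m+n≮m k m))) (+-identityʳ k)

squareSum : (ℕ → ℕ → ℕ) → ℕ → ℕ
squareSum f n = sumBelow (λ a → sumBelow (f a) n) n

cubeSum : (ℕ → ℕ → ℕ → ℕ) → ℕ → ℕ
cubeSum f n = sumBelow (λ a → squareSum (f a) n) n

-- [n+1]² = [n]² ∪ {b = n, a < n} ∪ {a = n}.
squareSum-suc : ∀ f n →
  squareSum f (suc n) ≡ squareSum f n + sumBelow (λ a → f a n) n + sumBelow (f n) (suc n)
squareSum-suc f n =
  cong (_+ sumBelow (f n) (suc n)) (sumBelow-+ (λ a → sumBelow (f a) n) (λ a → f a n) n)

-- [n+1]³ = [n]³ ∪ {c = n; a,b < n} ∪ {b = n; a < n} ∪ {a = n}.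
cubeSum-suc : ∀ f n → cubeSum f (suc n) ≡
  cubeSum f n + sumBelow (λ a → sumBelow (λ b → f a b n) n) n
              + sumBelow (λ a → sumBelow (f a n) (suc n)) n + squareSum (f n) (suc n)
cubeSum-suc f n = cong (_+ squareSum (f n) (suc n)) (begin
  sumBelow (λ a → squareSum (f a) (suc n)) n
    ≡⟨ sumBelow-cong n (λ a _ → squareSum-suc (f a) n) ⟩
  sumBelow (λ a → (squareSum (f a) n + sumBelow (λ b → f a b n) n) + sumBelow (f a n) (suc n)) n
    ≡⟨ sumBelow-+ _ (λ a → sumBelow (f a n) (suc n)) n ⟩
  sumBelow (λ a → squareSum (f a) n + sumBelow (λ b → f a b n) n) n + sumBelow (λ a → sumBelow (f a n) (suc n)) n
    ≡⟨ cong (_+ sumBelow (λ a → sumBelow (f a n) (suc n)) n) (sumBelow-+ (λ a → squareSum (f a) n) _ n) ⟩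
  cubeSum f n + sumBelow (λ a → sumBelow (λ b → f a b n) n) n + sumBelow (λ a → sumBelow (f a n) (suc n)) n ∎)
  where open ≡-Reasoning

module SmallBottom (k : ℕ) where

  tripleInd : ℕ → ℕ → ℕ → ℕ
  tripleInd a b c = indicator ((a <? k) ×-dec ((a <? b) ×-dec (b <? c)))

  pairInd : ℕ → ℕ → ℕ
  pairInd a b = indicator ((a <? k) ×-dec (a <? b))

  triples< : ℕ → ℕ
  triples< = cubeSum tripleInd

  pairs< : ℕ → ℕ
  pairs< = squareSum pairInd

  private
    no-between : ∀ {n c} → n < c → c < suc n → ⊥
    no-between n<c c<1+n = <⇒≱ n<c (≤-pred c<1+n)

  -- Of the three new faces of the cube [n+1]³ only the face c = n contains increasing
  -- triples, and those correspond to the pairs a<b<n.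
  triples<-suc : ∀ n → triples< (suc n) ≡ triples< n + pairs< n
  triples<-suc n = begin
    triples< (suc n)                         ≡⟨ cubeSum-suc tripleInd n ⟩
    triples< n + face-c + face-b + face-a    ≡⟨ cong (λ x → triples< n + x + face-b + face-a) face-c≡pairs ⟩
    triples< n + pairs< n + face-b + face-a  ≡⟨ cong₂ (λ x y → triples< n + pairs< n + x + y) face-b≡0 face-a≡0 ⟩
    triples< n + pairs< n + 0 + 0            ≡⟨ trans (+-identityʳ _) (+-identityʳ _) ⟩
    triples< n + pairs< n                    ∎
    where
    open ≡-Reasoning
    face-c face-b face-a : ℕ
    face-c = sumBelow (λ a → sumBelow (λ b → tripleInd a b n) n) n
    face-b = sumBelow (λ a → sumBelow (tripleInd a n) (suc n)) n
    face-a = squareSum (tripleInd n) (suc n)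
    face-c≡pairs : face-c ≡ pairs< n
    face-c≡pairs = sumBelow-cong n (λ a _ → sumBelow-cong n (λ b b<n →
      indicator-cong _ _ (λ { (a<k , a<b , _) → a<k , a<b }) (λ { (a<k , a<b) → a<k , a<b , b<n })))
    face-b≡0 : face-b ≡ 0
    face-b≡0 = sumBelow-zero n (λ a _ → sumBelow-zero (suc n) (λ c c≤n →
      indicator-no _ (λ { (_ , _ , n<c) → no-between n<c c≤n })))
    face-a≡0 : face-a ≡ 0
    face-a≡0 = sumBelow-zero (suc n) (λ b b≤n → sumBelow-zero (suc n) (λ c _ →
      indicator-no _ (λ { (_ , n<b , _) → no-between n<b b≤n })))

  -- Of the two new faces of the square [n+1]², only b = n contains pairs a<b;
  -- there are #{a < n : a < k} of them.
  pairs<-suc : ∀ n → pairs< (suc n) ≡ pairs< n + countBelow k n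
  pairs<-suc n = begin
    pairs< (suc n)                 ≡⟨ squareSum-suc pairInd n ⟩
    pairs< n + face-b + face-a     ≡⟨ cong₂ (λ x y → pairs< n + x + y) face-b≡count face-a≡0 ⟩
    pairs< n + countBelow k n + 0  ≡⟨ +-identityʳ _ ⟩
    pairs< n + countBelow k n      ∎
    where
    open ≡-Reasoning
    face-b face-a : ℕ
    face-b = sumBelow (λ a → pairInd a n) n
    face-a = sumBelow (pairInd n) (suc n)
    face-b≡count : face-b ≡ countBelow k n
    face-b≡count = sumBelow-cong n (λ a a<n → indicator-cong _ _ (λ { (a<k , _) → a<k }) (λ a<k → a<k , a<n))
    face-a≡0 : face-a ≡ 0
    face-a≡0 = sumBelow-zero (suc n) (λ b b≤n → indicator-no _ (λ { (_ , n<b) → no-between n<b b≤n }))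

  -- While n ≤ k the condition a < k is void:  P = C(n,2)  and  N = C(n,3).
  pairs<-initial : ∀ n → n ≤ k → 2 * pairs< n + n ≡ n * n
  pairs<-initial zero    _   = refl
  pairs<-initial (suc n) n<k rewrite pairs<-suc n | countBelow-≤ k n (<⇒≤ n<k) =
    trans (regroup (pairs< n) n) (trans (cong (_+ (2 * n + 1)) (pairs<-initial n (<⇒≤ n<k))) (square-suc n))
    where
    regroup : ∀ x n → 2 * (x + n) + suc n ≡ (2 * x + n) + (2 * n + 1)
    regroup = solve-∀
    square-suc : ∀ n → n * n + (2 * n + 1) ≡ suc n * suc n
    square-suc = solve-∀

  triples<-initial : ∀ n → n ≤ k → 6 * triples< n + 3 * (n * n) ≡ n * n * n + 2 * n
  triples<-initial zero    _   = refl
  triples<-initial (suc n) n<k rewrite triples<-suc n =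
    trans (regroup (triples< n) (pairs< n) n)
      (trans (cong₂ (λ u v → u + 3 * v + (3 * n + 3)) (triples<-initial n n≤k) (pairs<-initial n n≤k)) (cube-suc n))
    where
    n≤k : n ≤ k
    n≤k = <⇒≤ n<k
    regroup : ∀ N P n → 6 * (N + P) + 3 * (suc n * suc n) ≡ (6 * N + 3 * (n * n)) + 3 * (2 * P + n) + (3 * n + 3)
    regroup = solve-∀
    cube-suc : ∀ n → n * n * n + 2 * n + 3 * (n * n) + (3 * n + 3) ≡ suc n * suc n * suc n + 2 * suc n
    cube-suc = solve-∀

  -- Beyond k, every further vertex adds k pairs:  P(k,k+m) = C(k,2) + km.
  pairs<-closed : ∀ m → 2 * pairs< (k + m) + k ≡ k * k + 2 * k * m
  pairs<-closed zero = begin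
    2 * pairs< (k + 0) + k  ≡⟨ cong (λ n → 2 * pairs< n + k) (+-identityʳ k) ⟩
    2 * pairs< k + k        ≡⟨ pairs<-initial k ≤-refl ⟩
    k * k                   ≡⟨ no-extra k ⟩
    k * k + 2 * k * 0       ∎
    where
    open ≡-Reasoning
    no-extra : ∀ k → k * k ≡ k * k + 2 * k * 0
    no-extra = solve-∀
  pairs<-closed (suc m) rewrite +-suc k m | pairs<-suc (k + m) | countBelow-≥ k m =
    trans (regroup (pairs< (k + m)) k) (trans (cong (_+ 2 * k) (pairs<-closed m)) (step k m))
    where
    regroup : ∀ x k → 2 * (x + k) + k ≡ (2 * x + k) + 2 * k
    regroup = solve-∀
    step : ∀ k m → k * k + 2 * k * m + 2 * k ≡ k * k + 2 * k * suc m
    step = solve-∀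

  -- N(k,k+m) = C(k+m,3) - C(m,3), in the integral form
  --   6·N(k,k+m) + 3k(k+2m) = k(k² + 2 + 3mk + 3m²).
  triples<-closed : ∀ m → 6 * triples< (k + m) + 3 * k * (k + 2 * m) ≡ k * (k * k + 2 + 3 * m * k + 3 * m * m)
  triples<-closed zero = begin
    6 * triples< (k + 0) + 3 * k * (k + 2 * 0)  ≡⟨ cong (λ n → 6 * triples< n + 3 * k * (k + 2 * 0)) (+-identityʳ k) ⟩
    6 * triples< k + 3 * k * (k + 2 * 0)        ≡⟨ cong (6 * triples< k +_) (no-extra k) ⟩
    6 * triples< k + 3 * (k * k)                ≡⟨ triples<-initial k ≤-refl ⟩
    k * k * k + 2 * k                           ≡⟨ factor k ⟩
    k * (k * k + 2 + 3 * 0 * k + 3 * 0 * 0)     ∎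
    where
    open ≡-Reasoning
    no-extra : ∀ k → 3 * k * (k + 2 * 0) ≡ 3 * (k * k)
    no-extra = solve-∀
    factor : ∀ k → k * k * k + 2 * k ≡ k * (k * k + 2 + 3 * 0 * k + 3 * 0 * 0)
    factor = solve-∀
  triples<-closed (suc m) rewrite +-suc k m | triples<-suc (k + m) =
    trans (regroup (triples< (k + m)) (pairs< (k + m)) k m)
      (trans (cong₂ (λ u v → u + 3 * v + 3 * k) (triples<-closed m) (pairs<-closed m)) (step k m))
    where
    regroup : ∀ N P k m → 6 * (N + P) + 3 * k * (k + 2 * suc m) ≡ (6 * N + 3 * k * (k + 2 * m)) + 3 * (2 * P + k) + 3 * k
    regroup = solve-∀
    step : ∀ k m → k * (k * k + 2 + 3 * m * k + 3 * m * m) + 3 * (k * k + 2 * k * m) + 3 * k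
                 ≡ k * (k * k + 2 + 3 * suc m * k + 3 * suc m * suc m)
    step = solve-∀

open SmallBottom using (triples<; triples<-closed)

triples<-at : ∀ k m {n} → k + m ≡ n → 6 * triples< k n + 3 * k * (k + 2 * m) ≡ k * (k * k + 2 + 3 * m * k + 3 * m * m)
triples<-at k m refl = triples<-closed k m

strict-bound : ∀ a b N X Y A D → 6 * N + X ≡ Y → A + a * b * X ≡ a * b * Y + suc D → 6 * a * b * N < A
strict-bound a b N X Y A D 6N+X≡Y identity = +-cancelʳ-< (a * b * X) (6 * a * b * N) A (begin-strict
  6 * a * b * N + a * b * X  ≡⟨ factor a b N X ⟩
  a * b * (6 * N + X)        ≡⟨ cong (a * b *_) 6N+X≡Y ⟩
  a * b * Y                  <⟨ m<m+n (a * b * Y) z<s ⟩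
  a * b * Y + suc D          ≡⟨ sym identity ⟩
  A + a * b * X              ∎)
  where
  open ≤-Reasoning
  factor : ∀ a b N X → 6 * a * b * N + a * b * X ≡ a * b * (6 * N + X)
  factor = solve-∀

few-small-triples : ∀ k r → r < 2 → let t = 2 + (r + (3 + k) * 2) in
  6 * (t ∸ 2) * (t ∸ 1) * triples< k t < (t ∸ 3) ^ 2 * t ^ 3
few-small-triples k zero _ =
  strict-bound (6 + k * 2) (7 + k * 2) (triples< k (8 + k * 2)) _ _ _ _
    (triples<-at k (8 + k) (t≡k+m k)) (identity k)
  where
  t≡k+m : ∀ k → k + (8 + k) ≡ 8 + k * 2
  t≡k+m = solve-∀
  -- With t = 2k+8 and m = k+8:
  -- (t-3)²t³ + (t-2)(t-1)·3k(k+2m) = (t-2)(t-1)·k(k²+2+3mk+3m²) + (1 + D), D with positive coefficients.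
  identity : ∀ k → (5 + k * 2) * ((5 + k * 2) * 1) * ((8 + k * 2) * ((8 + k * 2) * ((8 + k * 2) * 1))) + (6 + k * 2) * (7 + k * 2) * (3 * k * (k + 2 * (8 + k)))
    ≡ (6 + k * 2) * (7 + k * 2) * (k * (k * k + 2 + 3 * (8 + k) * k + 3 * (8 + k) * (8 + k)))
      + (1 + (k * 13708 + (k * k) * 5686 + (k * k * k) * 1140 + (k * k * k * k) * 110 + (k * k * k * k * k) * 4 + 12799))
  identity = solve-∀
few-small-triples k (suc zero) _ =
  strict-bound (7 + k * 2) (8 + k * 2) (triples< k (9 + k * 2)) _ _ _ _
    (triples<-at k (9 + k) (t≡k+m k)) (identity k)
  where
  t≡k+m : ∀ k → k + (9 + k) ≡ 9 + k * 2
  t≡k+m = solve-∀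
  -- As above, now with t = 2k+9 and m = k+9.
  identity : ∀ k → (6 + k * 2) * ((6 + k * 2) * 1) * ((9 + k * 2) * ((9 + k * 2) * ((9 + k * 2) * 1))) + (7 + k * 2) * (8 + k * 2) * (3 * k * (k + 2 * (9 + k)))
    ≡ (7 + k * 2) * (8 + k * 2) * (k * (k * k + 2 + 3 * (9 + k) * k + 3 * (9 + k) * (9 + k)))
      + (1 + (k * 24296 + (k * k) * 8706 + (k * k * k) * 1508 + (k * k * k * k) * 126 + (k * k * k * k * k) * 4 + 26243))
  identity = solve-∀
few-small-triples k (suc (suc r)) (s≤s (s≤s ()))

edges≤triples< : ∀ {t} (E : 3Graph t) k →
  (∀ a b c → a <ᶠ b → b <ᶠ c → E a b c ≡ true → toℕ a < k) → numEdges E ≤ triples< k t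
edges≤triples< {t} E k bottom<k =
  ≤-trans (length-filter≤total _ Q? (λ { (a , b , c) (a<b , b<c , e) → bottom<k a b c a<b b<c e , a<b , b<c })
                               (triples t))
          (≤-reflexive count)
  where
  open SmallBottom k using (tripleInd)
  Q : Fin t × Fin t × Fin t → Set
  Q (a , b , c) = toℕ a < k × a <ᶠ b × b <ᶠ c
  Q? : Decidable Q
  Q? (a , b , c) = (toℕ a <? k) ×-dec ((toℕ a <? toℕ b) ×-dec (toℕ b <? toℕ c))
  count : total (λ x → indicator (Q? x)) (triples t) ≡ triples< k t
  count =
    trans (total-concatMap _ _ (allFin t)) (total-tabulate t id _ (λ a → squareSum (tripleInd a) t) (λ a →
      trans (total-concatMap _ _ (allFin t)) (total-tabulate t id _ (λ b → sumBelow (tripleInd (toℕ a) b) t) (λ b →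
        trans (total-map _ _ (allFin t)) (total-tabulate t id _ (tripleInd (toℕ a) (toℕ b)) (λ c → refl))))))

<ᶠ⇒≢ : ∀ {t} {x y : Fin t} → x <ᶠ y → ¬ x ≡ y
<ᶠ⇒≢ x<y refl = <-irrefl refl x<y

compress : ∀ {t} {E : 3Graph t} → LeftCompressed E → ∀ {i₁ i₂ i₃ j₁ j₂ j₃ : Fin t} →
  j₁ <ᶠ j₂ → j₂ <ᶠ j₃ → E j₁ j₂ j₃ ≡ true → i₁ <ᶠ i₂ → i₂ <ᶠ i₃ →
  i₁ ≤ᶠ j₁ → i₂ ≤ᶠ j₂ → i₃ ≤ᶠ j₃ → E i₁ i₂ i₃ ≡ true
compress lc {i₁} {i₂} {i₃} {j₁} {j₂} {j₃} j₁<j₂ j₂<j₃ e i₁<i₂ i₂<i₃ i₁≤j₁ i₂≤j₂ i₃≤j₃ =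
  lc j₁ j₂ j₃ i₁ i₂ i₃ j₁<j₂ j₂<j₃ e (<ᶠ⇒≢ i₁<i₂) (<ᶠ⇒≢ (<-trans i₁<i₂ i₂<i₃)) (<ᶠ⇒≢ i₂<i₃)
     i₁≤j₁ i₂≤j₂ i₃≤j₃ i₁ i₂ i₃ i₁<i₂ i₂<i₃ (inj₁ (refl , refl , refl))

EdgesBelow : ∀ {t} → 3Graph t → ℕ → Set
EdgesBelow {t} E s = ∀ (a b c : Fin t) → a <ᶠ b → b <ᶠ c → toℕ c < s → E a b c ≡ true

edgesBelow-tiny : ∀ {t} (E : 3Graph t) s → s ≤ 2 → EdgesBelow E s
edgesBelow-tiny E s s≤2 a b c a<b b<c c<s =
  ⊥-elim (<⇒≱ (<-≤-trans c<s s≤2) (≤-trans (s≤s (≤-trans z<s a<b)) b<c))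

-- The triple {k, k+1, k+2}: the largest increasing triple inside [k+3].
module TopTriple {t : ℕ} (E : 3Graph t) (lc : LeftCompressed E) (k : ℕ) (k+2<t : 2 + k < t) where

  private
    k+1<t : 1 + k < t
    k+1<t = <-trans (n<1+n (1 + k)) k+2<t
    k<t : k < t
    k<t = <-trans (n<1+n k) k+1<t

  top₁ top₂ top₃ : Fin t
  top₁ = fromℕ< k<t
  top₂ = fromℕ< k+1<t
  top₃ = fromℕ< k+2<t

  top₁-increasing : top₁ <ᶠ top₂
  top₁-increasing = subst₂ _<_ (sym (toℕ-fromℕ< k<t)) (sym (toℕ-fromℕ< k+1<t)) (n<1+n k)

  top₂-increasing : top₂ <ᶠ top₃
  top₂-increasing = subst₂ _<_ (sym (toℕ-fromℕ< k+1<t)) (sym (toℕ-fromℕ< k+2<t)) (n<1+n (1 + k))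

  top⇒edgesBelow : E top₁ top₂ top₃ ≡ true → EdgesBelow E (3 + k)
  top⇒edgesBelow e a b c a<b b<c c<k+3 =
    compress lc top₁-increasing top₂-increasing e a<b b<c
      (subst (toℕ a ≤_) (sym (toℕ-fromℕ< k<t)) (≤-pred (≤-trans a<b b≤k+1)))
      (subst (toℕ b ≤_) (sym (toℕ-fromℕ< k+1<t)) b≤k+1)
      (subst (toℕ c ≤_) (sym (toℕ-fromℕ< k+2<t)) (≤-pred c<k+3))
    where
    b≤k+1 : toℕ b ≤ 1 + k
    b≤k+1 = ≤-pred (≤-trans b<c (≤-pred c<k+3))

  high-edge⇒top : ∀ a b c → a <ᶠ b → b <ᶠ c → E a b c ≡ true → k ≤ toℕ a → E top₁ top₂ top₃ ≡ true
  high-edge⇒top a b c a<b b<c e k≤a =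
    compress lc a<b b<c e top₁-increasing top₂-increasing
      (subst (_≤ toℕ a) (sym (toℕ-fromℕ< k<t)) k≤a)
      (subst (_≤ toℕ b) (sym (toℕ-fromℕ< k+1<t)) k<b)
      (subst (_≤ toℕ c) (sym (toℕ-fromℕ< k+2<t)) (≤-trans (s≤s k<b) b<c))
    where
    k<b : k < toℕ b
    k<b = ≤-<-trans k≤a a<b

  dichotomy : EdgesBelow E (3 + k) ⊎ (∀ a b c → a <ᶠ b → b <ᶠ c → E a b c ≡ true → toℕ a < k)
  dichotomy with E top₁ top₂ top₃ in top-value
  ... | true  = inj₁ (top⇒edgesBelow top-value)
  ... | false = inj₂ bottom<k
    where
    bottom<k : ∀ a b c → a <ᶠ b → b <ᶠ c → E a b c ≡ true → toℕ a < k
    bottom<k a b c a<b b<c e with toℕ a <? k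
    ... | yes a<k = a<k
    ... | no  a≮k with () ← trans (sym (high-edge⇒top a b c a<b b<c e (≮⇒≥ a≮k))) top-value

initialSegment : ∀ {t s} → s ≤ t → List (Fin t)
initialSegment {s = s} s≤t = tabulate (λ (i : Fin s) → inject≤ i s≤t)

initialSegment-unique : ∀ {t s} (s≤t : s ≤ t) → Unique (initialSegment s≤t)
initialSegment-unique s≤t = tabulate⁺ (λ {i} {j} eq →
  toℕ-injective (trans (sym (toℕ-inject≤ i s≤t)) (trans (cong toℕ eq) (toℕ-inject≤ j s≤t))))

initialSegment-below : ∀ {t s} (s≤t : s ≤ t) {v} → v ∈ initialSegment s≤t → toℕ v < s
initialSegment-below s≤t v∈ with ∈-tabulate⁻ v∈
... | i , refl = subst (_< _) (sym (toℕ-inject≤ i s≤t)) (toℕ<n i)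

largest-listed : ∀ {t} {x y z a b c : Fin t} →
  (x ≡ a × y ≡ b × z ≡ c) ⊎ (x ≡ a × y ≡ c × z ≡ b) ⊎ (x ≡ b × y ≡ a × z ≡ c) ⊎
  (x ≡ b × y ≡ c × z ≡ a) ⊎ (x ≡ c × y ≡ a × z ≡ b) ⊎ (x ≡ c × y ≡ b × z ≡ a) →
  c ≡ x ⊎ c ≡ y ⊎ c ≡ z
largest-listed (inj₁ (_ , _ , z≡c))                             = inj₂ (inj₂ (sym z≡c))
largest-listed (inj₂ (inj₁ (_ , y≡c , _)))                      = inj₂ (inj₁ (sym y≡c))
largest-listed (inj₂ (inj₂ (inj₁ (_ , _ , z≡c))))               = inj₂ (inj₂ (sym z≡c))
largest-listed (inj₂ (inj₂ (inj₂ (inj₁ (_ , y≡c , _)))))        = inj₂ (inj₁ (sym y≡c))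
largest-listed (inj₂ (inj₂ (inj₂ (inj₂ (inj₁ (x≡c , _ , _)))))) = inj₁ (sym x≡c)
largest-listed (inj₂ (inj₂ (inj₂ (inj₂ (inj₂ (x≡c , _ , _)))))) = inj₁ (sym x≡c)

initialSegment-clique : ∀ {t s} (E : 3Graph t) (s≤t : s ≤ t) → EdgesBelow E s → IsClique E (initialSegment s≤t)
initialSegment-clique E s≤t edges =
  initialSegment-unique s≤t ,
  λ x y z x∈ y∈ z∈ _ _ _ a b c a<b b<c enum → edges a b c a<b b<c (c<s x∈ y∈ z∈ (largest-listed enum))
  where
  c<s : ∀ {x y z c} → x ∈ _ → y ∈ _ → z ∈ _ → c ≡ x ⊎ c ≡ y ⊎ c ≡ z → toℕ c < _
  c<s x∈ _  _  (inj₁ refl)        = initialSegment-below s≤t x∈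
  c<s _  y∈ _  (inj₂ (inj₁ refl)) = initialSegment-below s≤t y∈
  c<s _  _  z∈ (inj₂ (inj₂ refl)) = initialSegment-below s≤t z∈

half≤ : ∀ s r → s ≤ 2 + (r + s * 2)
half≤ s r = ≤-trans (m≤m*n s 2) (≤-trans (m≤n+m (s * 2) r) (m≤n+m (r + s * 2) 2))

edgesBelow-half : ∀ {t} (E : 3Graph t) → LeftCompressed E → ∀ s r → r < 2 → t ≡ 2 + (r + s * 2) →
  (t ∸ 3) ^ 2 * t ^ 3 ≤ 6 * (t ∸ 2) * (t ∸ 1) * numEdges E → EdgesBelow E s
edgesBelow-half E lc 0 r r<2 refl many = edgesBelow-tiny E 0 z≤n
edgesBelow-half E lc 1 r r<2 refl many = edgesBelow-tiny E 1 (s≤s z≤n)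
edgesBelow-half E lc 2 r r<2 refl many = edgesBelow-tiny E 2 ≤-refl
edgesBelow-half E lc (suc (suc (suc k))) r r<2 refl many with TopTriple.dichotomy E lc k (half≤ (3 + k) r)
... | inj₁ clique    = clique
... | inj₂ bottom<k = ⊥-elim (<⇒≱ (few-small-triples k r r<2)
                                   (≤-trans many (*-monoʳ-≤ (6 * (r + (3 + k) * 2) * (1 + (r + (3 + k) * 2))) (edges≤triples< E k bottom<k))))

corollary2 : (t : ℕ) → 3 ≤ t → (E : 3Graph t) → LeftCompressed E →
    (t ∸ 3) ^ 2 * t ^ 3 ≤ 6 * (t ∸ 2) * (t ∸ 1) * numEdges E →
    Σ (List (Fin t)) (λ S → length S ≡ (t ∸ 2) / 2 × IsClique E S)
corollary2 t 3≤t E lc many =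
  initialSegment s≤t , length-tabulate _ ,
  initialSegment-clique E s≤t (edgesBelow-half E lc s r (m%n<n (t ∸ 2) 2) t≡2+r+2s many)
  where
  s r : ℕ
  s = (t ∸ 2) / 2
  r = (t ∸ 2) % 2
  t≡2+r+2s : t ≡ 2 + (r + s * 2)
  t≡2+r+2s = trans (sym (m+[n∸m]≡n (≤-trans (n≤1+n 2) 3≤t))) (cong (2 +_) (m≡m%n+[m/n]*n (t ∸ 2) 2))
  s≤t : s ≤ t
  s≤t = subst (s ≤_) (sym t≡2+r+2s) (half≤ s r)
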